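{- Let $A$ be a finite alphabet, $FX=2\times(\mathcal{P}_{\mathsf f}X)^A$ and $GX=2\times X^A$ on $\mathsf{Set}$, let $\Sigma$ be a signature with finitely many operation symbols of finite arity, and let $\lambda:\Sigma(F\times\mathrm{Id})\Rightarrow F(\Sigma+\mathrm{Id})$ be a natural transformation (e.g. one arising from a bipointed NDA SOS specification), with induced operations $\alpha:\Sigma(\nu F)\to\nu F$. Define the operations $\tilde\alpha=q\circ\alpha\circ\Sigma s:\Sigma(\mathcal{P}(A^*))\to\mathcal{P}(A^*)$ on formal languages, where $s:\mathcal{P}(A^*)\to\nu F$ and $q:\nu F\to\mathcal{P}(A^*)$ are as described in the context. Then the set of regular languages over $A$ is closed under all operations of $\tilde\alpha$.
   Context: $2=\{0,1\}$, $\mathcal{P}_{\mathsf f}$ is the finite powerset functor, a signature is identified with the polynomial functor $\Sigma X=\coprod_fX^{|f|}$. $(\nu F,t)$ is the final $F$-coalgebra and $\alpha$ is the unique map with $t\circ\alpha=F[\alpha,\mathrm{id}]\circ\lambda_{\nu F}\circ\Sigma\langle t,\mathrm{id}\rangle$. The final $G$-coalgebra is $\mathcal{P}(A^*)$ with $o(L)=1$ iff the empty word is in $L$ and $L\mapsto(a\mapsto L_a)$, $L_a=\{w\mid aw\in L\}$. The map $s$ sends a language $L$ to the image in $\nu F$ of the state $L$ of the $F$-coalgebra $\mathcal{P}(A^*)\to 2\times\mathcal{P}_{\mathsf f}(\mathcal{P}(A^*))^A$, $L\mapsto (o(L),\,a\mapsto\{L_a\})$ (a deterministic automaton viewed as non-deterministic).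 The map $q$ sends an element $x\in\nu F$ to the language it accepts as a state of the non-deterministic automaton $(\nu F,t)$: writing $t(x)=(o(x),\delta(x))$, a word $a_1\cdots a_k$ is in $q(x)$ iff there are $x=x_0,x_1,\dots,x_k$ with $x_i\in\delta(x_{i-1})(a_i)$ and $o(x_k)=1$. Then $q\circ s=\mathrm{id}$. A language is regular if it is accepted by a finite deterministic automaton. -}

module Defs where

open import Data.Nat using (ℕ; zero; suc; _<?_)
open import Data.Fin using (Fin; zero; suc; toℕ; fromℕ<)
open import Data.Bool using (Bool; true; false)
open import Data.List using (List; []; _∷_)
open import Data.Product using (Σ; Σ-syntax; ∃; ∃-syntax; _×_; _,_; proj₁; proj₂; <_,_>)
open import Data.Sum using (_⊎_; inj₁; inj₂)
open import Function using (id; _∘_)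
open import Function.Bundles using (_⇔_)
open import Relation.Binary.PropositionalEquality using (_≡_)
open import Relation.Nullary using (yes; no)

record Sig : Set where
  field
    nOps : ℕ
    ar   : Fin nOps → ℕ
open Sig public

⟦_⟧ : Sig → Set → Set
⟦ S ⟧ X = Σ[ f ∈ Fin (nOps S) ] (Fin (ar S f) → X)

Σmap : (S : Sig) {X Y : Set} → (X → Y) → ⟦ S ⟧ X → ⟦ S ⟧ Y
Σmap S h (f , xs) = f , (h ∘ xs)

data ΣLift (S : Sig) {X Y : Set} (R : X → Y → Set) : ⟦ S ⟧ X → ⟦ S ⟧ Y → Set where
  lift : ∀ {f} {xs : Fin (ar S f) → X} {ys : Fin (ar S f) → Y} →
         (∀ i → R (xs i) (ys i)) → ΣLift S R (f , xs) (f , ys)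

-- Finite powerset, represented by a finite family (read as its image).

Pf : Set → Set
Pf X = Σ[ n ∈ ℕ ] (Fin n → X)

Pfmap : {X Y : Set} → (X → Y) → Pf X → Pf Y
Pfmap h (n , xs) = n , (h ∘ xs)

-- Egli–Milner relation lifting; with R = _≡_ it is equality of the
-- represented finite subsets.
PfLift : {X Y : Set} (R : X → Y → Set) → Pf X → Pf Y → Set
PfLift R (n , xs) (m , ys) =
  (∀ i → ∃[ j ] R (xs i) (ys j)) × (∀ j → ∃[ i ] R (xs i) (ys j))

F : ℕ → Set → Set
F k X = Bool × (Fin k → Pf X)

Fmap : (k : ℕ) {X Y : Set} → (X → Y) → F k X → F k Y
Fmap k h (b , d) = b , (λ a → Pfmap h (d a))

FLift : (k : ℕ) {X Y : Set} (R : X → Y → Set) → F k X → F k Y → Set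
FLift k R (b , d) (b' , d') = (b ≡ b') × (∀ a → PfLift R (d a) (d' a))

EqΣ+ : (S : Sig) {Y : Set} → (⟦ S ⟧ Y ⊎ Y) → (⟦ S ⟧ Y ⊎ Y) → Set
EqΣ+ S (inj₁ u) (inj₁ v) = ΣLift S _≡_ u v
EqΣ+ S (inj₁ u) (inj₂ y) = Data.Empty.⊥ where import Data.Empty
EqΣ+ S (inj₂ x) (inj₁ v) = Data.Empty.⊥ where import Data.Empty
EqΣ+ S (inj₂ x) (inj₂ y) = x ≡ y

EqF× : (k : ℕ) {X : Set} → F k X × X → F k X × X → Set
EqF× k (p , x) (p' , x') = FLift k _≡_ p p' × (x ≡ x')

_⊎map_ : {X Y X' Y' : Set} → (X → Y) → (X' → Y') → X ⊎ X' → Y ⊎ Y'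
(h ⊎map g) (inj₁ x) = inj₁ (h x)
(h ⊎map g) (inj₂ x) = inj₂ (g x)

Lam : ℕ → Sig → Set₁
Lam k S = (X : Set) → ⟦ S ⟧ (F k X × X) → F k (⟦ S ⟧ X ⊎ X)

-- λ_X is a well-defined function on the quotient representation
-- (equal finite subsets give equal results).
WellDefined : (k : ℕ) (S : Sig) → Lam k S → Set₁
WellDefined k S lam = (X : Set) (u v : ⟦ S ⟧ (F k X × X)) →
  ΣLift S (EqF× k) u v → FLift k (EqΣ+ S) (lam X u) (lam X v)

Natural : (k : ℕ) (S : Sig) → Lam k S → Set₁
Natural k S lam = (X Y : Set) (h : X → Y) (u : ⟦ S ⟧ (F k X × X)) →
  FLift k (EqΣ+ S)
    (lam Y (Σmap S (λ { (p , x) → Fmap k h p , h x }) u))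
    (Fmap k (Σmap S h ⊎map h) (lam X u))

-- Without quotients, F X = 2 × (P_f X)^A is
-- represented by the polynomial functor 2 × (∐_n X^n)^A, whose final
-- coalgebra (the M-type of finitely branching A-labelled trees with a
-- Boolean at each node) is encoded without coinduction as a function from
-- addresses (sequences of (letter, child index)) to node shapes.  νF is
-- this type read up to bisimilarity; everything below is invariant under it.

Shape : ℕ → Set
Shape k = Bool × (Fin k → ℕ)

Address : ℕ → Set
Address k = List (Fin k × ℕ)

νF : ℕ → Set
νF k = Address k → Shape k

out : {k : ℕ} → νF k → Bool
out x = proj₁ (x [])

child : {k : ℕ} (x : νF k) (a : Fin k) → Fin (proj₂ (x []) a) → νF k
child x a i p = x ((a , toℕ i) ∷ p)

next : {k : ℕ} → νF k → Fin k → Pf (νF k)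
next x a = proj₂ (x []) a , child x a

t : (k : ℕ) → νF k → F k (νF k)
t k x = out x , next x

unfold : (k : ℕ) {X : Set} → (X → F k X) → X → νF k
unfold k c x [] = proj₁ (c x) , (λ a → proj₁ (proj₂ (c x) a))
unfold k c x ((a , j) ∷ p) with j <? proj₁ (proj₂ (c x) a)
... | yes j<n = unfold k c (proj₂ (proj₂ (c x) a) (fromℕ< j<n)) p
... | no _    = false , (λ _ → 0)

-- α : Σ(νF) → νF, the unique map with t ∘ α = F[α,id] ∘ λ ∘ Σ⟨t,id⟩,
-- obtained as [α,id] = unfold of the coalgebra c on Σ νF + νF.
αc : (k : ℕ) (S : Sig) → Lam k S → (⟦ S ⟧ (νF k) ⊎ νF k) → F k (⟦ S ⟧ (νF k) ⊎ νF k)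
αc k S lam (inj₁ u) = lam (νF k) (Σmap S < t k , id > u)
αc k S lam (inj₂ x) = Fmap k inj₂ (t k x)

α : (k : ℕ) (S : Sig) → Lam k S → ⟦ S ⟧ (νF k) → νF k
α k S lam u = unfold k (αc k S lam) (inj₁ u)

Word : ℕ → Set
Word k = List (Fin k)

Lang : ℕ → Set
Lang k = Word k → Bool

LangP : ℕ → Set₁
LangP k = Word k → Set

sCoalg : (k : ℕ) → Lang k → F k (Lang k)
sCoalg k L = L [] , (λ a → 1 , (λ _ w → L (a ∷ w)))

s : (k : ℕ) → Lang k → νF k
s k = unfold k (sCoalg k)

q : (k : ℕ) → νF k → LangP k
q k x []      = out x ≡ true
q k x (a ∷ w) = Σ[ i ∈ Fin (proj₁ (next x a)) ] q k (proj₂ (next x a) i) w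

α̃ : (k : ℕ) (S : Sig) → Lam k S → ⟦ S ⟧ (Lang k) → LangP k
α̃ k S lam = q k ∘ α k S lam ∘ Σmap S (s k)

record DFA (k : ℕ) : Set where
  field
    nStates : ℕ
    start   : Fin nStates
    δ       : Fin nStates → Fin k → Fin nStates
    accept  : Fin nStates → Bool
open DFA public

run : {k : ℕ} (D : DFA k) → Fin (nStates D) → Word k → Bool
run D st []      = accept D st
run D st (a ∷ w) = run D (δ D st a) w

accepts : {k : ℕ} → DFA k → Word k → Bool
accepts D = run D (start D)

Regular : (k : ℕ) → LangP k → Set
Regular k P = Σ[ D ∈ DFA k ] (∀ w → P w ⇔ (accepts D w ≡ true))

⟪_⟫ : {k : ℕ} → Lang k → LangP k
⟪ L ⟫ w = L w ≡ true

module Submission where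

-- Languages are read off states of non-deterministic automata (F-coalgebras) by
-- `accepted`; bisimilar states accept the same language, and q is `accepted` for the
-- final coalgebra (νF, t), which every coalgebra unfolds into.  For a coalgebra c on
-- X, the λ-extension `ext c` on Σ X + X gives the behaviour of a single operation
-- applied to states of X, and α is the unfolding of `ext t`.  Naturality of λ turns a
-- coalgebra morphism h into a bisimulation between extensions (`transfer`).
-- Given DFAs for the arguments L_i, the deterministic automaton of derivatives of the
-- L_i maps into νF (hitting s L_i) and into the finite disjoint union of the DFAs, so
-- α̃(f, L) is the language of a state of the extension of a finite automaton.  That
-- extension is finite up to argumentwise equality (`finRep-ext`), hence bisimilar to
-- an automaton on finitely many codes, which the subset construction
-- (`Determinisation`) turns into the required DFA.

open import Defs
open import Data.Bool using (Bool; true; false)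
import Data.Bool as Bool
open import Data.Fin.Patterns using (0F; 1F)
open import Data.Fin using (Fin; zero; suc; _≟_; toℕ; cast; join; splitAt; finToFun; funToFin)
open import Data.Fin.Properties
  using (any?; toℕ-cast; toℕ<n; fromℕ<-toℕ; splitAt-join; finToFun-funToFin)
open import Data.List using ([]; _∷_)
open import Data.Nat using (ℕ; zero; suc; _+_; _^_; _<?_)
open import Data.Product using (Σ; Σ-syntax; ∃-syntax; _×_; _,_; proj₁; proj₂; <_,_>)
import Data.Product as Product
open import Data.Sum using (_⊎_; inj₁; inj₂)
import Data.Sum as Sum
open import Data.Sum.Relation.Binary.Pointwise using (Pointwise)
open import Data.Empty using (⊥-elim)
open import Function using (id; _∘_; flip)
open import Function.Bundles using (_⇔_; mk⇔; Equivalence)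
open import Function.Related.Propositional using (module EquationalReasoning; equivalence)
open import Function.Properties.Equivalence using () renaming (sym to ⇔-sym; trans to ⇔-trans)
open import Relation.Binary.Structures using (IsEquivalence)
open import Relation.Binary.PropositionalEquality
  using (_≡_; refl; sym; trans; cong; subst; _≗_; module ≡-Reasoning)
open import Relation.Nullary using (Dec; yes; no; does)
open import Relation.Nullary.Decidable using (_×-dec_)

NDA : ℕ → Set → Set
NDA k X = X → F k X

accepted : {k : ℕ} {X : Set} → NDA k X → X → LangP k
accepted c x []      = proj₁ (c x) ≡ true
accepted c x (a ∷ w) = Σ[ i ∈ Fin (proj₁ (proj₂ (c x) a)) ] accepted c (proj₂ (proj₂ (c x) a) i) w

module _ {X Y : Set} where

  PfLift-map : {R R' : X → Y → Set} → (∀ {x y} → R x y → R' x y) →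
    (u : Pf X) (v : Pf Y) → PfLift R u v → PfLift R' u v
  PfLift-map f _ _ (forth , back) = Product.map₂ f ∘ forth , Product.map₂ f ∘ back

  PfLift-converse : {R : X → Y → Set} (u : Pf X) (v : Pf Y) →
    PfLift R u v → PfLift (flip R) v u
  PfLift-converse _ _ (forth , back) = back , forth

module _ {X Y Z : Set} where

  PfLift-compose : {R₁ : X → Y → Set} {R₂ : Y → Z → Set} {R₃ : X → Z → Set} →
    (∀ {x y z} → R₁ x y → R₂ y z → R₃ x z) →
    (u : Pf X) (v : Pf Y) (w : Pf Z) → PfLift R₁ u v → PfLift R₂ v w → PfLift R₃ u w
  PfLift-compose comp _ _ _ (forth₁ , back₁) (forth₂ , back₂) =
    (λ i → let (j , r₁) = forth₁ i ; (l , r₂) = forth₂ j in l , comp r₁ r₂) ,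
    (λ l → let (j , r₂) = back₂ l ; (i , r₁) = back₁ j in i , comp r₁ r₂)

module _ {k : ℕ} {X Y : Set} where

  FLift-map : {R R' : X → Y → Set} → (∀ {x y} → R x y → R' x y) →
    {u : F k X} {v : F k Y} → FLift k R u v → FLift k R' u v
  FLift-map {R} {R'} f {_ , d} {_ , d'} (o , p) =
    o , λ a → PfLift-map {R = R} {R'} f (d a) (d' a) (p a)

  FLift-converse : {R : X → Y → Set} {u : F k X} {v : F k Y} →
    FLift k R u v → FLift k (flip R) v u
  FLift-converse {R} {_ , d} {_ , d'} (o , p) =
    sym o , λ a → PfLift-converse {R = R} (d a) (d' a) (p a)

module _ {k : ℕ} {X Y Z : Set} where

  FLift-compose : {R₁ : X → Y → Set} {R₂ : Y → Z → Set} {R₃ : X → Z → Set} →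
    (∀ {x y z} → R₁ x y → R₂ y z → R₃ x z) →
    {u : F k X} {v : F k Y} {w : F k Z} → FLift k R₁ u v → FLift k R₂ v w → FLift k R₃ u w
  FLift-compose {R₁} {R₂} {R₃} comp {_ , d} {_ , d'} {_ , d''} (o₁ , p₁) (o₂ , p₂) =
    trans o₁ o₂ ,
    λ a → PfLift-compose {R₁ = R₁} {R₂} {R₃} comp (d a) (d' a) (d'' a) (p₁ a) (p₂ a)

module _ {k : ℕ} {X : Set} where

  FLift-refl : {R : X → X → Set} → (∀ {x} → R x x) → (u : F k X) → FLift k R u u
  FLift-refl r _ = refl , λ a → (λ i → i , r) , (λ j → j , r)

  FLift-reflexive : {u v : F k X} → u ≡ v → FLift k _≡_ u v
  FLift-reflexive {u} refl = FLift-refl {R = _≡_} refl u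

IsBisimulation : {k : ℕ} {X Y : Set} → NDA k X → NDA k Y → (X → Y → Set) → Set
IsBisimulation {k} c d R = ∀ {x y} → R x y → FLift k R (c x) (d y)

IsMorphism : {k : ℕ} {X Y : Set} → NDA k X → NDA k Y → (X → Y) → Set
IsMorphism {k} d c h = ∀ x → FLift k _≡_ (Fmap k h (d x)) (c (h x))

bisimulation-⊆ : {k : ℕ} {X Y : Set} {c : NDA k X} {d : NDA k Y} {R : X → Y → Set} →
  IsBisimulation c d R → ∀ {x y} → R x y → ∀ w → accepted c x w → accepted d y w
bisimulation-⊆ bis r []      acc = trans (sym (proj₁ (bis r))) acc
bisimulation-⊆ bis r (a ∷ w) (i , acc) =
  let (j , r') = proj₁ (proj₂ (bis r) a) i in j , bisimulation-⊆ bis r' w acc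

converse-bisimulation : {k : ℕ} {X Y : Set} {c : NDA k X} {d : NDA k Y} {R : X → Y → Set} →
  IsBisimulation c d R → IsBisimulation d c (flip R)
converse-bisimulation {R = R} bis r = FLift-converse {R = R} (bis r)

bisimulation-⇔ : {k : ℕ} {X Y : Set} {c : NDA k X} {d : NDA k Y} {R : X → Y → Set} →
  IsBisimulation c d R → ∀ {x y} → R x y → ∀ w → accepted c x w ⇔ accepted d y w
bisimulation-⇔ {c = c} {d} {R} bis r w =
  mk⇔ (bisimulation-⊆ bis r w)
      (bisimulation-⊆ {c = d} {c} {flip R} (converse-bisimulation {c = c} {d} bis) r w)

accepted-cong : {k : ℕ} {X : Set} {c d : NDA k X} → (∀ x → c x ≡ d x) →
  ∀ x w → accepted c x w ⇔ accepted d x w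
accepted-cong {c = c} {d} e x = bisimulation-⇔ bisim refl
  where
  bisim : IsBisimulation c d _≡_
  bisim {x} refl = FLift-reflexive (e x)

q-accepted : (k : ℕ) (x : νF k) (w : Word k) → q k x w ⇔ accepted (t k) x w
q-accepted k x []      = mk⇔ id id
q-accepted k x (a ∷ w) =
  mk⇔ (Product.map₂ λ {i} → Equivalence.to (q-accepted k (child x a i) w))
      (Product.map₂ λ {i} → Equivalence.from (q-accepted k (child x a i) w))

unfold-child : {k : ℕ} {X : Set} (c : NDA k X) (x : X) (a : Fin k)
  (i : Fin (proj₁ (proj₂ (c x) a))) →
  ∀ p → unfold k c x ((a , toℕ i) ∷ p) ≡ unfold k c (proj₂ (proj₂ (c x) a) i) p
unfold-child {k} c x a i p with toℕ i <? proj₁ (proj₂ (c x) a)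
... | yes i<n = cong (λ j → unfold k c (proj₂ (proj₂ (c x) a) j) p) (fromℕ<-toℕ i i<n)
... | no  i≮n = ⊥-elim (i≮n (toℕ<n i))

unfold-bisimulation : {k : ℕ} {X : Set} (c : NDA k X) →
  IsBisimulation c (t k) (λ x y → unfold k c x ≗ y)
unfold-bisimulation {k} c {x} {y} x≗y = cong proj₁ (x≗y []) , λ a →
  let n≡m = cong (λ shape → proj₂ shape a) (x≗y [])
      matching : (i : Fin (proj₁ (proj₂ (c x) a))) (j : Fin (proj₂ (y []) a)) →
                 toℕ i ≡ toℕ j → unfold k c (proj₂ (proj₂ (c x) a) i) ≗ child y a j
      matching i j i≡j p = begin
        unfold k c (proj₂ (proj₂ (c x) a) i) p ≡⟨ sym (unfold-child c x a i p) ⟩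
        unfold k c x ((a , toℕ i) ∷ p)         ≡⟨ x≗y _ ⟩
        y ((a , toℕ i) ∷ p)                    ≡⟨ cong (λ n → y ((a , n) ∷ p)) i≡j ⟩
        y ((a , toℕ j) ∷ p)                    ∎
  in (λ i → cast n≡m i , matching i _ (sym (toℕ-cast n≡m i))) ,
     (λ j → cast (sym n≡m) j , matching _ j (toℕ-cast (sym n≡m) j))
  where open ≡-Reasoning

q-unfold : {k : ℕ} {X : Set} (c : NDA k X) (x : X) (w : Word k) →
  q k (unfold k c x) w ⇔ accepted c x w
q-unfold {k} c x w =
  ⇔-trans (q-accepted k (unfold k c x) w)
          (⇔-sym (bisimulation-⇔ {R = λ x y → unfold k c x ≗ y} (unfold-bisimulation c)
                                 (λ _ → refl) w))

module _ {S : Sig} {Y : Set} where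

  EqΣ+-isEquivalence : IsEquivalence (EqΣ+ S {Y})
  EqΣ+-isEquivalence = record { refl = λ {p} → reflexive p ; sym = symmetric ; trans = transitive }
    where
    reflexive : ∀ p → EqΣ+ S p p
    reflexive (inj₁ _) = lift λ _ → refl
    reflexive (inj₂ _) = refl

    symmetric : ∀ {p p'} → EqΣ+ S p p' → EqΣ+ S p' p
    symmetric {inj₁ _} {inj₁ _} (lift e) = lift (sym ∘ e)
    symmetric {inj₂ _} {inj₂ _} e        = sym e

    transitive : ∀ {p p' p''} → EqΣ+ S p p' → EqΣ+ S p' p'' → EqΣ+ S p p''
    transitive {inj₁ _} {inj₁ _} {inj₁ _} (lift e) (lift e') = lift λ i → trans (e i) (e' i)
    transitive {inj₂ _} {inj₂ _} {inj₂ _} e e'               = trans e e'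

-- Extending an NDA c on X by the operations of Σ, with behaviour given by λ: the
-- operational model of the specification on terms of depth one over X.
module Lifting {k : ℕ} (S : Sig) (lam : Lam k S) where

  private
    module EqΣ+ {Y : Set} = IsEquivalence (EqΣ+-isEquivalence {S} {Y})

  ext : {X : Set} → NDA k X → NDA k (⟦ S ⟧ X ⊎ X)
  ext {X} c (inj₁ u) = lam X (Σmap S < c , id > u)
  ext     c (inj₂ x) = Fmap k inj₂ (c x)

  αc-ext : ∀ p → αc k S lam p ≡ ext (t k) p
  αc-ext (inj₁ _) = refl
  αc-ext (inj₂ _) = refl

  ext-respects : WellDefined k S lam → {X : Set} (c : NDA k X) →
    IsBisimulation (ext c) (ext c) (EqΣ+ S)
  ext-respects wd {X} c {inj₁ _} {inj₁ _} (lift e) =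
    wd X _ _ (lift λ i → FLift-reflexive (cong c (e i)) , e i)
  ext-respects wd     c {inj₂ _} {inj₂ _} refl = FLift-refl {R = EqΣ+ S} EqΣ+.refl _

  morphism-bisimulation : Natural k S lam → WellDefined k S lam →
    {X Y : Set} {d : NDA k X} {c : NDA k Y} {h : X → Y} → IsMorphism d c h →
    IsBisimulation (ext d) (ext c) (λ p p' → EqΣ+ S ((Σmap S h ⊎map h) p) p')
  morphism-bisimulation nat wd {X} {Y} {d} {c} {h} hom {inj₁ (f , xs)} {inj₁ _} (lift e) =
    FLift-compose {R₁ = λ p p' → EqΣ+ S p' ((Σmap S h ⊎map h) p)} {R₂ = EqΣ+ S}
      (λ r₁ r₂ → EqΣ+.trans (EqΣ+.sym r₁) r₂)
      (FLift-converse {R = EqΣ+ S} (nat X Y h (Σmap S < d , id > (f , xs))))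
      (wd Y _ _ (lift λ i → hom-at (e i) , e i))
    where
    hom-at : ∀ {x y} → h x ≡ y → FLift k _≡_ (Fmap k h (d x)) (c y)
    hom-at {x} h≡ = FLift-compose {R₁ = _≡_} {_≡_} trans (hom x) (FLift-reflexive (cong c h≡))
  morphism-bisimulation nat wd hom {inj₂ x} {inj₂ _} refl = hom x

  transfer : Natural k S lam → WellDefined k S lam →
    {X Y : Set} {d : NDA k X} {c : NDA k Y} {h : X → Y} → IsMorphism d c h →
    ∀ u w → accepted (ext d) (inj₁ u) w ⇔ accepted (ext c) (inj₁ (Σmap S h u)) w
  transfer nat wd {d = d} {c} {h} hom u w =
    bisimulation-⇔ {c = ext d} {ext c} {λ p p' → EqΣ+ S ((Σmap S h ⊎map h) p) p'}
      (morphism-bisimulation nat wd hom) (lift λ _ → refl) w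

record FinRep (X : Set) (_≈_ : X → X → Set) : Set where
  field
    size          : ℕ
    encode        : X → Fin size
    decode        : Fin size → X
    decode-encode : ∀ x → decode (encode x) ≈ x
open FinRep

finRep-retract : {X Y : Set} {R : X → X → Set} {R' : Y → Y → Set} → FinRep Y R' →
  (to : X → Y) (from : Y → X) → (∀ {y x} → R' y (to x) → R (from y) x) → FinRep X R
finRep-retract r to from back = record
  { size          = size r
  ; encode        = encode r ∘ to
  ; decode        = from ∘ decode r
  ; decode-encode = λ x → back (decode-encode r (to x))
  }

finRep-Fin : (n : ℕ) → FinRep (Fin n) _≡_
finRep-Fin n = record { size = n ; encode = id ; decode = id ; decode-encode = λ _ → refl }

finRep-⊎ : {X Y : Set} {R : X → X → Set} {R' : Y → Y → Set} →
  FinRep X R → FinRep Y R' → FinRep (X ⊎ Y) (Pointwise R R')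
finRep-⊎ {X} {Y} {R} {R'} r r' = record
  { size          = size r + size r'
  ; encode        = encode⊎
  ; decode        = decode⊎
  ; decode-encode = decode-encode⊎
  }
  where
  encode⊎ : X ⊎ Y → Fin (size r + size r')
  encode⊎ = join (size r) (size r') ∘ Sum.map (encode r) (encode r')

  decode⊎ : Fin (size r + size r') → X ⊎ Y
  decode⊎ = Sum.map (decode r) (decode r') ∘ splitAt (size r)

  decode-encode⊎ : ∀ p → Pointwise R R' (decode⊎ (encode⊎ p)) p
  decode-encode⊎ (inj₁ x) rewrite splitAt-join (size r) (size r') (inj₁ (encode r x)) =
    Pointwise.inj₁ (decode-encode r x)
  decode-encode⊎ (inj₂ y) rewrite splitAt-join (size r) (size r') (inj₂ (encode r' y)) =
    Pointwise.inj₂ (decode-encode r' y)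

data SameIndex {m : ℕ} {P : Fin m → Set} (R : ∀ i → P i → P i → Set) :
    Σ (Fin m) P → Σ (Fin m) P → Set where
  same : ∀ {i x y} → R i x y → SameIndex R (i , x) (i , y)

-- A finite sum of finitely represented types is finitely represented: the type of
-- index m + 1 is the binary sum of the fibre over zero and the sum of the others.
finRep-Σ : {m : ℕ} {P : Fin m → Set} {R : ∀ i → P i → P i → Set} →
  (∀ i → FinRep (P i) (R i)) → FinRep (Σ (Fin m) P) (SameIndex R)
finRep-Σ {zero} r = record
  { size = 0 ; encode = λ { (() , _) } ; decode = λ () ; decode-encode = λ { (() , _) } }
finRep-Σ {suc m} {P} {R} r =
  finRep-retract (finRep-⊎ (r zero) (finRep-Σ (r ∘ suc))) to from back
  where
  to : Σ (Fin (suc m)) P → P zero ⊎ Σ (Fin m) (P ∘ suc)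
  to (zero  , x) = inj₁ x
  to (suc i , x) = inj₂ (i , x)

  from : P zero ⊎ Σ (Fin m) (P ∘ suc) → Σ (Fin (suc m)) P
  from (inj₁ x)       = zero , x
  from (inj₂ (i , x)) = suc i , x

  back : ∀ {y x} → Pointwise (R zero) (SameIndex (R ∘ suc)) y (to x) → SameIndex R (from y) x
  back {x = zero  , _} (Pointwise.inj₁ e)        = same e
  back {x = suc _ , _} (Pointwise.inj₂ (same e)) = same e

finRep-→ : {Y : Set} {R : Y → Y → Set} → FinRep Y R → (a : ℕ) →
  FinRep (Fin a → Y) (λ g g' → ∀ i → R (g i) (g' i))
finRep-→ {R = R} r a = record
  { size          = size r ^ a
  ; encode        = λ g → funToFin (encode r ∘ g)
  ; decode        = λ c → decode r ∘ finToFun c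
  ; decode-encode = λ g i →
      subst (λ c → R (decode r c) (g i)) (sym (finToFun-funToFin (encode r ∘ g) i))
            (decode-encode r (g i))
  }

Regular-resp : {k : ℕ} {P P' : LangP k} → (∀ w → P w ⇔ P' w) → Regular k P' → Regular k P
Regular-resp P⇔P' (D , P'⇔D) = D , λ w → ⇔-trans (P⇔P' w) (P'⇔D w)

bit : {A : Set} → Dec A → Fin 2
bit (yes _) = 1F
bit (no  _) = 0F

bit-correct : {A : Set} (d : Dec A) → bit d ≡ 1F ⇔ A
bit-correct (yes a)  = mk⇔ (λ _ → a) (λ _ → refl)
bit-correct (no  ¬a) = mk⇔ (λ ()) (⊥-elim ∘ ¬a)

does-correct : {A : Set} (d : Dec A) → does d ≡ true ⇔ A
does-correct (yes a)  = mk⇔ (λ _ → a) (λ _ → refl)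
does-correct (no  ¬a) = mk⇔ (λ ()) (⊥-elim ∘ ¬a)

-- A state of the DFA is a subset of Fin n, coded by the number below 2 ^ n
-- whose digits are its characteristic function.
module Determinisation {k n : ℕ} (c : NDA k (Fin n)) where

  Subset : Set
  Subset = Fin (2 ^ n)

  infix 4 _∈_
  _∈_ : Fin n → Subset → Set
  i ∈ S = finToFun S i ≡ 1F

  subset : {P : Fin n → Set} → (∀ i → Dec (P i)) → Subset
  subset P? = funToFin (bit ∘ P?)

  ∈-subset : {P : Fin n → Set} (P? : ∀ i → Dec (P i)) (i : Fin n) → i ∈ subset P? ⇔ P i
  ∈-subset P? i rewrite finToFun-funToFin (bit ∘ P?) i = bit-correct (P? i)

  successor : (i : Fin n) (a : Fin k) → Fin (proj₁ (proj₂ (c i) a)) → Fin n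
  successor i a = proj₂ (proj₂ (c i) a)

  step? : (S : Subset) (a : Fin k) (j : Fin n) →
    Dec (∃[ i ] (i ∈ S × ∃[ m ] successor i a m ≡ j))
  step? S a j = any? λ i → (finToFun S i ≟ 1F) ×-dec any? (λ m → successor i a m ≟ j)

  final? : (S : Subset) → Dec (∃[ i ] (i ∈ S × proj₁ (c i) ≡ true))
  final? S = any? λ i → (finToFun S i ≟ 1F) ×-dec (proj₁ (c i) Bool.≟ true)

  dfa : Fin n → DFA k
  dfa i₀ = record
    { nStates = 2 ^ n
    ; start   = subset (_≟ i₀)
    ; δ       = λ S a → subset (step? S a)
    ; accept  = does ∘ final?
    }

  run-subset : ∀ i₀ S w → run (dfa i₀) S w ≡ true ⇔ (∃[ i ] (i ∈ S × accepted c i w))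
  run-subset i₀ S []      = does-correct (final? S)
  run-subset i₀ S (a ∷ w) = mk⇔ forth back
    where
    S' : Subset
    S' = subset (step? S a)
    forth : run (dfa i₀) S' w ≡ true → ∃[ i ] (i ∈ S × accepted c i (a ∷ w))
    forth acc with Equivalence.to (run-subset i₀ S' w) acc
    ... | j , j∈S' , acc' with Equivalence.to (∈-subset (step? S a) j) j∈S'
    ... | i , i∈S , m , refl = i , i∈S , m , acc'
    back : ∃[ i ] (i ∈ S × accepted c i (a ∷ w)) → run (dfa i₀) S' w ≡ true
    back (i , i∈S , m , acc) = Equivalence.from (run-subset i₀ S' w)
      (successor i a m , Equivalence.from (∈-subset (step? S a) _) (i , i∈S , m , refl) , acc)

  nda-regular : ∀ i₀ → Regular k (accepted c i₀)
  nda-regular i₀ = dfa i₀ , λ w → ⇔-sym (⇔-trans (run-subset i₀ (start (dfa i₀)) w) (from-start w))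
    where
    from-start : ∀ w → (∃[ i ] (i ∈ start (dfa i₀) × accepted c i w)) ⇔ accepted c i₀ w
    from-start w = mk⇔
      (λ { (i , i∈start , acc) → subst (λ i → accepted c i w)
                                       (Equivalence.to (∈-subset (_≟ i₀) i) i∈start) acc })
      (λ acc → i₀ , Equivalence.from (∈-subset (_≟ i₀) i₀) refl , acc)

-- An NDA on a finitely represented state space whose transitions respect the
-- representing equivalence accepts only regular languages: relating each state to
-- its code gives a bisimulation with an NDA on the codes, which is determinised.
finite-nda-regular : {k : ℕ} {X : Set} {_≈_ : X → X → Set} → IsEquivalence _≈_ →
  (r : FinRep X _≈_) (c : NDA k X) → IsBisimulation c c _≈_ →
  ∀ x → Regular k (accepted c x)
finite-nda-regular {k} {X} {_≈_} ≈-equiv r c respects x =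
  Regular-resp
    (bisimulation-⇔ {c = c} {on-codes} {≈-decode} to-codes (≈.sym (decode-encode r x)))
    (Determinisation.nda-regular on-codes (encode r x))
  where
  module ≈ = IsEquivalence ≈-equiv

  on-codes : NDA k (Fin (size r))
  on-codes = Fmap k (encode r) ∘ c ∘ decode r

  ≈-decode : X → Fin (size r) → Set
  ≈-decode y j = y ≈ decode r j

  to-codes : IsBisimulation c on-codes ≈-decode
  to-codes y≈ = FLift-map {R = _≈_} {λ y y' → y ≈ decode r (encode r y')}
                  (λ y≈y' → ≈.trans y≈y' (≈.sym (decode-encode r _))) (respects y≈)

finRep-ext : (S : Sig) {Y : Set} → FinRep Y _≡_ → FinRep (⟦ S ⟧ Y ⊎ Y) (EqΣ+ S)
finRep-ext S {Y} r = finRep-retract (finRep-⊎ (finRep-Σ λ f → finRep-→ r (ar S f)) r) id id back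
  where
  back : ∀ {p p'} →
    Pointwise (SameIndex λ f (g g' : Fin (ar S f) → Y) → ∀ i → g i ≡ g' i) _≡_ p p' → EqΣ+ S p p'
  back (Pointwise.inj₁ (same e)) = lift e
  back (Pointwise.inj₂ e)        = e

ext-regular : {k : ℕ} (S : Sig) (lam : Lam k S) → WellDefined k S lam →
  {Y : Set} → FinRep Y _≡_ → (c : NDA k Y) →
  ∀ u → Regular k (accepted (Lifting.ext S lam c) (inj₁ u))
ext-regular S lam wd r c u =
  finite-nda-regular EqΣ+-isEquivalence (finRep-ext S r) (ext c) (ext-respects wd c) (inj₁ u)
  where open Lifting S lam

det : {k : ℕ} {X : Set} → (X → Bool) → (X → Fin k → X) → NDA k X
det out step x = out x , λ a → 1 , λ _ → step x a

det-morphism : {k : ℕ} {X Y : Set} {out : X → Bool} {step : X → Fin k → X}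
  {out' : Y → Bool} {step' : Y → Fin k → Y} {h : X → Y} →
  (∀ x → out x ≡ out' (h x)) → (∀ x a → h (step x a) ≡ step' (h x) a) →
  IsMorphism (det out step) (det out' step') h
det-morphism o≡ δ≡ x = o≡ x , λ a → (λ _ → zero , δ≡ x a) , (λ _ → zero , δ≡ x a)

-- derivative u L is the language of words w with reverse u ++ w in L: the word u is
-- stored most recent letter first, so that reading a letter a turns u into a ∷ u.
derivative : {k : ℕ} → Word k → Lang k → Lang k
derivative []      L = L
derivative (a ∷ u) L = λ w → derivative u L (a ∷ w)

derivative-cong : {k : ℕ} {L L' : Lang k} → L ≗ L' → ∀ u → derivative u L ≗ derivative u L'
derivative-cong L≗L' []      = L≗L'
derivative-cong L≗L' (a ∷ u) w = derivative-cong L≗L' u (a ∷ w)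

-- The state a DFA reaches from st after reading reverse u.
after : {k : ℕ} (D : DFA k) → Fin (nStates D) → Word k → Fin (nStates D)
after D st []      = st
after D st (a ∷ u) = δ D (after D st u) a

derivative-run : {k : ℕ} (D : DFA k) (st : Fin (nStates D)) (u : Word k) →
  derivative u (run D st) ≗ run D (after D st u)
derivative-run D st []      w = refl
derivative-run D st (a ∷ u) w = derivative-run D st u (a ∷ w)

-- For languages Ls accepted by DFAs D: the deterministic automaton of derivatives of
-- the Ls i maps both into νF (sending (i, []) to s (Ls i)) and into the finite
-- disjoint union of the D i (sending (i, []) to the start state of D i).
module Family {k m : ℕ} (Ls : Fin m → Lang k) (D : Fin m → DFA k)
              (Ls≗D : ∀ i → Ls i ≗ accepts (D i)) where

  Residual : Set
  Residual = Fin m × Word k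

  residual-out : Residual → Bool
  residual-out (i , u) = derivative u (Ls i) []

  residual-step : Residual → Fin k → Residual
  residual-step (i , u) a = i , a ∷ u

  residuals : NDA k Residual
  residuals = det residual-out residual-step

  to-νF : Residual → νF k
  to-νF (i , u) = s k (derivative u (Ls i))

  -- the a-successor of s L in νF is, definitionally, s of the derivative of L by a
  to-νF-morphism : IsMorphism residuals (t k) to-νF
  to-νF-morphism _ = refl , λ a → (λ _ → zero , refl) , (λ { zero → zero , refl })

  State : Set
  State = Σ (Fin m) λ i → Fin (nStates (D i))

  state-out : State → Bool
  state-out (i , st) = accept (D i) st

  state-step : State → Fin k → State
  state-step (i , st) a = i , δ (D i) st a

  states : NDA k State
  states = det state-out state-step

  to-state : Residual → State
  to-state (i , u) = i , after (D i) (start (D i)) u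

  to-state-morphism : IsMorphism residuals states to-state
  to-state-morphism = det-morphism {out = residual-out} {residual-step} {state-out} {state-step}
    (λ { (i , u) → trans (derivative-cong (Ls≗D i) u [])
                         (derivative-run (D i) (start (D i)) u []) })
    (λ _ _ → refl)

  finRep-State : FinRep State _≡_
  finRep-State = finRep-retract (finRep-Σ λ i → finRep-Fin (nStates (D i))) id id
    λ { (same refl) → refl }

Bool-⇔-≡ : {b b' : Bool} → (b ≡ true ⇔ b' ≡ true) → b ≡ b'
Bool-⇔-≡ {false} {false} _     = refl
Bool-⇔-≡ {false} {true}  b⇔b' = Equivalence.from b⇔b' refl
Bool-⇔-≡ {true}  {_}     b⇔b' = sym (Equivalence.to b⇔b' refl)

-- Both sides
-- are languages of the λ-extension of the derivatives automaton, read through s into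
-- νF and through the DFAs into a finite automaton, respectively.
corollary5p6 : (k : ℕ) (S : Sig) (lam : Lam k S) →
    Natural k S lam → WellDefined k S lam →
    (f : Fin (nOps S)) (Ls : Fin (ar S f) → Lang k) →
    ((i : Fin (ar S f)) → Regular k ⟪ Ls i ⟫) →
    Regular k (α̃ k S lam (f , Ls))
corollary5p6 k S lam nat wd f Ls regular =
  Regular-resp chain (ext-regular S lam wd finRep-State states starts)
  where
  D : Fin (ar S f) → DFA k
  D i = proj₁ (regular i)

  open Family Ls D (λ i w → Bool-⇔-≡ (proj₂ (regular i) w))
  open Lifting S lam
  open EquationalReasoning {k = equivalence}

  initial : ⟦ S ⟧ Residual
  initial = f , λ i → i , []

  starts : ⟦ S ⟧ State
  starts = f , λ i → i , start (D i)

  chain : ∀ w → α̃ k S lam (f , Ls) w ⇔ accepted (ext states) (inj₁ starts) w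
  chain w = begin
    α̃ k S lam (f , Ls) w
      ∼⟨ q-unfold (αc k S lam) _ w ⟩
    accepted (αc k S lam) (inj₁ (f , s k ∘ Ls)) w
      ∼⟨ accepted-cong αc-ext _ w ⟩
    accepted (ext (t k)) (inj₁ (f , s k ∘ Ls)) w
      ∼⟨ ⇔-sym (transfer nat wd {h = to-νF} to-νF-morphism initial w) ⟩
    accepted (ext residuals) (inj₁ initial) w
      ∼⟨ transfer nat wd {h = to-state} to-state-morphism initial w ⟩
    accepted (ext states) (inj₁ starts) w
      ∎
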